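{- Let $N$ be a T-net of order $m$. Then the number of Eulerian cycles of $N$ satisfies $|N|\le 2^{m-1}$.
   Context: A T-net of order $m$ is a finite directed multigraph (loops and parallel edges allowed) with $m$ nodes and $2m$ directed edges in which every node has indegree $2$ and outdegree $2$. An Eulerian cycle is a closed walk traversing every edge exactly once; Eulerian cycles are regarded as cyclic sequences of edges, two being identified if one is a rotation (change of starting point) of the other. $|N|$ denotes the number of distinct Eulerian cycles of $N$. -}

module Defs where

open import Data.Nat using (ℕ; _*_)
open import Data.Fin using (Fin)
open import Data.List using (List; []; _∷_; length; filter; allFin; drop; take; _++_)
open import Data.List.Relation.Unary.All using (All)
open import Data.List.Relation.Unary.AllPairs using (AllPairs)
open import Data.List.Relation.Binary.Permutation.Propositional using (_↭_)
open import Data.Product using (∃)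
open import Relation.Binary.PropositionalEquality using (_≡_)
open import Relation.Nullary using (¬_)
open import Data.Fin using (_≟_)

record Digraph (m : ℕ) : Set where
  field
    src : Fin (2 * m) → Fin m
    tgt : Fin (2 * m) → Fin m
open Digraph public

indeg : ∀ {m} → Digraph m → Fin m → ℕ
indeg {m} G v = length (filter (λ e → tgt G e ≟ v) (allFin (2 * m)))

outdeg : ∀ {m} → Digraph m → Fin m → ℕ
outdeg {m} G v = length (filter (λ e → src G e ≟ v) (allFin (2 * m)))

IsTNet : ∀ {m} → Digraph m → Set
IsTNet {m} G = (v : Fin m) → (indeg G v ≡ 2) × (outdeg G v ≡ 2)
  where open import Data.Product using (_×_)

Walk : ∀ {m} → Digraph m → List (Fin (2 * m)) → Set
Walk G [] = Data.Unit.⊤ where import Data.Unit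
Walk G (e ∷ []) = Data.Unit.⊤ where import Data.Unit
Walk G (e ∷ f ∷ es) = (tgt G e ≡ src G f) × Walk G (f ∷ es)
  where open import Data.Product using (_×_)

Closes : ∀ {m} → Digraph m → List (Fin (2 * m)) → Set
Closes G [] = Data.Unit.⊤ where import Data.Unit
Closes G (e ∷ es) = go e (e ∷ es)
  where
  import Data.Unit
  go : Fin _ → List (Fin _) → Set
  go e₀ [] = Data.Unit.⊤
  go e₀ (x ∷ []) = tgt G x ≡ src G e₀
  go e₀ (x ∷ y ∷ xs) = go e₀ (y ∷ xs)

record Eulerian {m} (G : Digraph m) : Set where
  constructor euler
  field
    edges  : List (Fin (2 * m))
    perm   : edges ↭ allFin (2 * m)
    walk   : Walk G edges
    closed : Closes G edges
open Eulerian public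

-- two Eulerian sequences represent the same cyclic sequence iff one is a
-- rotation (change of starting point) of the other
Rotation : ∀ {m} {G : Digraph m} → Eulerian G → Eulerian G → Set
Rotation c d = ∃ λ k → edges d ≡ drop k (edges c) ++ take k (edges c)

-- "|N| ≤ k": the number of rotation classes of Eulerian cycles is at most k,
-- i.e. any list of pairwise non-rotation-equivalent Eulerian cycles has length ≤ k.
NumEulerianCycles≤ : ∀ {m} → Digraph m → ℕ → Set
NumEulerianCycles≤ G k =
  (cs : List (Eulerian G)) → AllPairs (λ c d → ¬ Rotation c d) cs → length cs Data.Nat.≤ k
  where import Data.Nat

-- Fix an edge e₀ and rotate every Eulerian cycle so that it starts with e₀. For each node v
-- record one bit: whether the cycle first leaves v through the lowest-numbered out-edge of v.
-- Two rooted cycles with the same bits coincide: where they first differ they leave a common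
-- node v through different edges, and as v has only two out-edges, neither of which occurs in
-- the shared prefix, these are the first exits from v, so the bits at v differ. The bit at the
-- source of e₀ is forced, leaving m - 1 free bits; the pigeonhole principle does the rest.

module Submission where

open import Defs
open import Data.Nat using (ℕ; suc; _*_; _≤_; _^_; _∸_; _≤?_; s≤s)
open import Data.Nat.Properties using (≤-reflexive; ≰⇒>; suc-injective)
open import Data.Fin using (Fin; _≟_; punchIn; punchOut; funToFin; finToFun)
open import Data.Fin.Properties using (pigeonhole; punchIn-punchOut; finToFun-funToFin; 2↔Bool)
import Data.Fin as Fin
open import Data.Bool using (Bool)
open import Data.Maybe using (Maybe; just)
import Data.Maybe.Properties as Maybe
open import Data.Unit using (tt)
open import Data.List using (List; []; _∷_; _++_; _∷ʳ_; length; filter; allFin; drop; take; lookup; find; head)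
open import Data.List.Properties using (++-identityʳ; ++-assoc; ∷ʳ-++; ∷-injective)
open import Data.List.Membership.Propositional using (_∈_)
open import Data.List.Membership.Propositional.Properties using (∈-filter⁺; ∈-allFin; ∈-∃++; ∈-lookup)
open import Data.List.Relation.Unary.Any using (here; there)
open import Data.List.Relation.Unary.All as All using (All; []; _∷_)
open import Data.List.Relation.Unary.All.Properties using (++⁻ʳ)
open import Data.List.Relation.Unary.AllPairs using (AllPairs; []; _∷_)
open import Data.List.Relation.Unary.Unique.Propositional using (Unique)
open import Data.List.Relation.Unary.Unique.Propositional.Properties using (allFin⁺)
open import Data.List.Relation.Binary.Permutation.Propositional using (_↭_; ↭⇒↭ₛ; ↭-sym; ↭-trans)
open import Data.List.Relation.Binary.Permutation.Propositional.Properties using (++-comm; ∈-resp-↭; ↭-length)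
open import Data.List.Relation.Binary.Permutation.Setoid.Properties using (Unique-resp-↭)
open import Data.Product using (∃; ∃₂; _×_; _,_; proj₁; proj₂)
open import Data.Sum using (_⊎_; inj₁; inj₂)
import Data.Sum as Sum
open import Level using (0ℓ)
open import Function using (_∘_; Inverse)
open import Relation.Nullary using (¬_; Dec; yes; no; does; contradiction)
open import Relation.Nullary.Decidable using (dec-true; dec-false)
open import Relation.Unary using (Decidable)
open import Relation.Binary using (Rel; DecidableEquality)
open import Relation.Binary.PropositionalEquality

module _ {A : Set} where

  find-++ : ∀ {P : A → Set} (P? : Decidable P) {xs ys : List A} {y} →
            All (¬_ ∘ P) xs → P y → find P? (xs ++ y ∷ ys) ≡ just y
  find-++ P? {[]} {y = y} [] py with P? y
  ... | yes _ = refl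
  ... | no ¬py = contradiction py ¬py
  find-++ P? {x ∷ xs} (¬px ∷ ¬pxs) py with P? x
  ... | yes px = contradiction px ¬px
  ... | no _ = find-++ P? ¬pxs py

  Unique⇒∉-prefix : ∀ {xs ys : List A} {y} → Unique (xs ++ y ∷ ys) → All (_≢ y) xs
  Unique⇒∉-prefix {[]} _ = []
  Unique⇒∉-prefix {x ∷ xs} (x∉ ∷ u) = All.head (++⁻ʳ xs x∉) ∷ Unique⇒∉-prefix u

  ∈-two-distinct : ∀ {xs : List A} {a b e} → length xs ≤ 2 → a ≢ b →
                   a ∈ xs → b ∈ xs → e ∈ xs → e ≡ a ⊎ e ≡ b
  ∈-two-distinct {_ ∷ []} _ a≢b (here refl) (here refl) _ = contradiction refl a≢b
  ∈-two-distinct {_ ∷ _ ∷ []} _ a≢b (here refl) (here refl) _ = contradiction refl a≢b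
  ∈-two-distinct {_ ∷ _ ∷ []} _ a≢b (there (here refl)) (there (here refl)) _ = contradiction refl a≢b
  ∈-two-distinct {_ ∷ _ ∷ []} _ _ (here refl) _ (here refl) = inj₁ refl
  ∈-two-distinct {_ ∷ _ ∷ []} _ _ _ (here refl) (here refl) = inj₂ refl
  ∈-two-distinct {_ ∷ _ ∷ []} _ _ (there (here refl)) _ (there (here refl)) = inj₁ refl
  ∈-two-distinct {_ ∷ _ ∷ []} _ _ _ (there (here refl)) (there (here refl)) = inj₂ refl
  ∈-two-distinct {_ ∷ _ ∷ _ ∷ _} (s≤s (s≤s ())) _ _ _ _

  head-two-distinct : ∀ {xs : List A} {a b} → length xs ≤ 2 → a ≢ b →
                      a ∈ xs → b ∈ xs → head xs ≡ just a ⊎ head xs ≡ just b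
  head-two-distinct {x ∷ _} len a≢b a∈ b∈ =
    Sum.map (cong just) (cong just) (∈-two-distinct len a≢b a∈ b∈ (here refl))

  does-≟-separates : (_≟ᴬ_ : DecidableEquality A) → ∀ {x y z} → x ≢ y →
                     z ≡ x ⊎ z ≡ y → does (x ≟ᴬ z) ≢ does (y ≟ᴬ z)
  does-≟-separates _≟ᴬ_ {x} {y} x≢y (inj₁ refl)
    rewrite dec-true (x ≟ᴬ x) refl | dec-false (y ≟ᴬ x) (x≢y ∘ sym) = λ ()
  does-≟-separates _≟ᴬ_ {x} {y} x≢y (inj₂ refl)
    rewrite dec-false (x ≟ᴬ y) x≢y | dec-true (y ≟ᴬ y) refl = λ ()

  lastFrom : A → List A → A
  lastFrom x [] = x
  lastFrom _ (y ∷ ys) = lastFrom y ys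

  lastFrom-++ : ∀ x xs y ys → lastFrom x (xs ++ y ∷ ys) ≡ lastFrom y ys
  lastFrom-++ x [] y ys = refl
  lastFrom-++ _ (x ∷ xs) y ys = lastFrom-++ x xs y ys

  ++-split : ∀ (ws xs ys zs : List A) → ws ++ xs ≡ ys ++ zs →
             (∃ λ t → ys ≡ ws ++ t × xs ≡ t ++ zs) ⊎ (∃ λ t → ws ≡ ys ++ t × zs ≡ t ++ xs)
  ++-split [] xs ys zs eq = inj₁ (ys , refl , eq)
  ++-split (w ∷ ws) xs [] zs eq = inj₂ (w ∷ ws , refl , sym eq)
  ++-split (w ∷ ws) xs (y ∷ ys) zs eq with ∷-injective eq
  ... | refl , eq′ = Sum.map (λ (t , p , q) → t , cong (w ∷_) p , q)
                             (λ (t , p , q) → t , cong (w ∷_) p , q)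
                             (++-split ws xs ys zs eq′)

  drop-length-++ : ∀ (xs ys : List A) → drop (length xs) (xs ++ ys) ≡ ys
  drop-length-++ [] ys = refl
  drop-length-++ (x ∷ xs) ys = drop-length-++ xs ys

  take-length-++ : ∀ (xs ys : List A) → take (length xs) (xs ++ ys) ≡ xs
  take-length-++ [] ys = refl
  take-length-++ (x ∷ xs) ys = cong (x ∷_) (take-length-++ xs ys)

  Rotated : Rel (List A) 0ℓ
  Rotated xs ys = ∃₂ λ p q → xs ≡ p ++ q × ys ≡ q ++ p

  Rotated-sym : ∀ {xs ys} → Rotated xs ys → Rotated ys xs
  Rotated-sym (p , q , xs≡ , ys≡) = q , p , ys≡ , xs≡

  Rotated-trans : ∀ {xs ys zs} → Rotated xs ys → Rotated ys zs → Rotated xs zs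
  Rotated-trans (p , q , refl , refl) (p′ , q′ , eq , refl) with ++-split q p p′ q′ eq
  ... | inj₁ (t , refl , refl) = t , q′ ++ q , ++-assoc t q′ q , sym (++-assoc q′ q t)
  ... | inj₂ (t , refl , refl) = p ++ p′ , t , sym (++-assoc p p′ t) , ++-assoc t p p′

  Rotated⇒↭ : ∀ {xs ys} → Rotated xs ys → xs ↭ ys
  Rotated⇒↭ (p , q , refl , refl) = ++-comm p q

  Rotated⇒drop-take : ∀ {xs ys} → Rotated xs ys → ∃ λ k → ys ≡ drop k xs ++ take k xs
  Rotated⇒drop-take (p , q , refl , refl) =
    length p , sym (cong₂ _++_ (drop-length-++ p q) (take-length-++ p q))

  AllPairs-lookup : ∀ {ℓ} {R : Rel A ℓ} {xs} → AllPairs R xs →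
                    ∀ {i j} → i Fin.< j → R (lookup xs i) (lookup xs j)
  AllPairs-lookup (Rx ∷ _) {Fin.zero} {Fin.suc j} _ = All.lookup Rx (∈-lookup j)
  AllPairs-lookup (_ ∷ R*) {Fin.suc i} {Fin.suc j} (s≤s i<j) = AllPairs-lookup R* i<j

  length≤-by-code : ∀ {k ℓ} {R : Rel A ℓ} (code : A → Fin k) →
                    (∀ {x y} → code x ≡ code y → R x y) →
                    ∀ xs → AllPairs (λ x y → ¬ R x y) xs → length xs ≤ k
  length≤-by-code {k} code sameCode⇒R xs ¬R* with length xs ≤? k
  ... | yes len≤k = len≤k
  ... | no len≰k with pigeonhole (≰⇒> len≰k) (code ∘ lookup xs)
  ...   | i , j , i<j , eq = contradiction (sameCode⇒R eq) (AllPairs-lookup ¬R* i<j)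

encode : ∀ {n} → (Fin n → Bool) → Fin (2 ^ n)
encode f = funToFin (Inverse.from 2↔Bool ∘ f)

encode-injective : ∀ {n} (f g : Fin n → Bool) → encode f ≡ encode g → ∀ i → f i ≡ g i
encode-injective f g eq i = begin
  f i                   ≡⟨ strictlyInverseˡ (f i) ⟨
  to (from (f i))       ≡⟨ cong to from-eq ⟩
  to (from (g i))       ≡⟨ strictlyInverseˡ (g i) ⟩
  g i                   ∎
  where
  open ≡-Reasoning
  open Inverse 2↔Bool using (to; from; strictlyInverseˡ)
  from-eq : from (f i) ≡ from (g i)
  from-eq = trans (sym (finToFun-funToFin _ i))
                  (trans (cong (λ c → finToFun c i) eq) (finToFun-funToFin _ i))

module _ {m} (G : Digraph m) where

  Walk-++⁻ˡ : ∀ xs {ys} → Walk G (xs ++ ys) → Walk G xs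
  Walk-++⁻ˡ [] _ = tt
  Walk-++⁻ˡ (_ ∷ []) _ = tt
  Walk-++⁻ˡ (_ ∷ x ∷ xs) (link , w) = link , Walk-++⁻ˡ (x ∷ xs) w

  Walk-++⁻ʳ : ∀ xs {ys} → Walk G (xs ++ ys) → Walk G ys
  Walk-++⁻ʳ [] w = w
  Walk-++⁻ʳ (_ ∷ []) {[]} _ = tt
  Walk-++⁻ʳ (_ ∷ []) {_ ∷ _} (_ , w) = w
  Walk-++⁻ʳ (_ ∷ x ∷ xs) (_ , w) = Walk-++⁻ʳ (x ∷ xs) w

  Walk-++⁺ : ∀ x xs {y ys} → Walk G (x ∷ xs) → Walk G (y ∷ ys) →
             tgt G (lastFrom x xs) ≡ src G y → Walk G (x ∷ xs ++ y ∷ ys)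
  Walk-++⁺ x [] _ wy link = link , wy
  Walk-++⁺ x (x′ ∷ xs) (link , wx) wy link′ = link , Walk-++⁺ x′ xs wx wy link′

  Closes⇒link : ∀ x xs → Closes G (x ∷ xs) → tgt G (lastFrom x xs) ≡ src G x
  Closes⇒link x [] c = c
  Closes⇒link x (_ ∷ []) c = c
  Closes⇒link x (_ ∷ y ∷ xs) c = Closes⇒link x (y ∷ xs) c

  rotate-closed-walk : ∀ xs y ys → Walk G (xs ++ y ∷ ys) → Closes G (xs ++ y ∷ ys) →
                       Walk G (y ∷ ys ++ xs)
  rotate-closed-walk [] y ys w _ = subst (λ zs → Walk G (y ∷ zs)) (sym (++-identityʳ ys)) w
  rotate-closed-walk (x ∷ xs) y ys w c =
    Walk-++⁺ y ys (Walk-++⁻ʳ (x ∷ xs) w) (Walk-++⁻ˡ (x ∷ xs) w)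
      (trans (cong (tgt G) (sym (lastFrom-++ x xs y ys))) (Closes⇒link x (xs ++ y ∷ ys) c))

  rootAt : (e : Fin (2 * m)) (c : Eulerian G) →
           ∃ λ T → Rotated (edges c) (e ∷ T) × Walk G (e ∷ T)
  rootAt e c with ∈-∃++ (∈-resp-↭ (↭-sym (perm c)) (∈-allFin e))
  ... | xs , ys , split =
    ys ++ xs , (xs , e ∷ ys , split , refl) ,
    rotate-closed-walk xs e ys (subst (Walk G) split (walk c)) (subst (Closes G) split (closed c))

  exits : Fin m → List (Fin (2 * m))
  exits v = filter (λ e → src G e ≟ v) (allFin (2 * m))

  firstExit : Fin m → List (Fin (2 * m)) → Maybe (Fin (2 * m))
  firstExit v = find (λ e → src G e ≟ v)

  exitSignature : List (Fin (2 * m)) → Fin m → Bool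
  exitSignature L v = does (Maybe.≡-dec _≟_ (firstExit v L) (head (exits v)))

  exitSignature-head : ∀ e T → exitSignature (e ∷ T) (src G e) ≡
                               does (Maybe.≡-dec _≟_ (just e) (head (exits (src G e))))
  exitSignature-head e T =
    cong (λ f → does (Maybe.≡-dec _≟_ f (head (exits (src G e)))))
      (find-++ (λ e′ → src G e′ ≟ src G e) {xs = []} {ys = T} [] refl)

  module _ (outdeg≤2 : ∀ v → outdeg G v ≤ 2) where

    exit∈exits : ∀ {e v} → src G e ≡ v → e ∈ exits v
    exit∈exits {e} {v} = ∈-filter⁺ (λ e → src G e ≟ v) (∈-allFin e)

    exit-two-distinct : ∀ {a b e v} → a ≢ b → src G a ≡ v → src G b ≡ v → src G e ≡ v →
                        e ≡ a ⊎ e ≡ b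
    exit-two-distinct {v = v} a≢b a↦v b↦v e↦v =
      ∈-two-distinct (outdeg≤2 v) a≢b (exit∈exits a↦v) (exit∈exits b↦v) (exit∈exits e↦v)

    exitSignature-separates : ∀ {q a A b B} → Unique (q ++ a ∷ A) → Unique (q ++ b ∷ B) →
                              a ≢ b → src G a ≡ src G b →
                              exitSignature (q ++ a ∷ A) (src G a) ≢ exitSignature (q ++ b ∷ B) (src G a)
    exitSignature-separates {q} {a} {A} {b} {B} uA uB a≢b sa≡sb =
      subst₂ (λ fa fb → does (Maybe.≡-dec _≟_ fa preferred) ≢
                        does (Maybe.≡-dec _≟_ fb preferred))
        (sym firstA) (sym firstB)
        (does-≟-separates (Maybe.≡-dec _≟_) (a≢b ∘ Maybe.just-injective)
          (head-two-distinct (outdeg≤2 (src G a)) a≢b (exit∈exits refl) (exit∈exits (sym sa≡sb))))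
      where
      preferred : Maybe (Fin (2 * m))
      preferred = head (exits (src G a))
      noExitBefore : All (λ e → src G e ≢ src G a) q
      noExitBefore = All.zipWith
        (λ (e≢a , e≢b) e↦ → Sum.[ e≢a , e≢b ] (exit-two-distinct a≢b refl (sym sa≡sb) e↦))
        (Unique⇒∉-prefix uA , Unique⇒∉-prefix uB)
      firstA : firstExit (src G a) (q ++ a ∷ A) ≡ just a
      firstA = find-++ _ noExitBefore refl
      firstB : firstExit (src G a) (q ++ b ∷ B) ≡ just b
      firstB = find-++ _ noExitBefore (sym sa≡sb)

    module _ {L₁ L₂} (u₁ : Unique L₁) (u₂ : Unique L₂)
             (sameSignature : ∀ v → exitSignature L₁ v ≡ exitSignature L₂ v) where

      next-edge-agrees : ∀ {q a A b B} → L₁ ≡ q ++ a ∷ A → L₂ ≡ q ++ b ∷ B →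
                         src G a ≡ src G b → a ≡ b
      next-edge-agrees {q} {a} {A} {b} {B} L₁≡ L₂≡ sa≡sb with a ≟ b
      ... | yes a≡b = a≡b
      ... | no a≢b = contradiction
        (subst₂ (λ L L′ → exitSignature L (src G a) ≡ exitSignature L′ (src G a)) L₁≡ L₂≡
          (sameSignature (src G a)))
        (exitSignature-separates (subst Unique L₁≡ u₁) (subst Unique L₂≡ u₂) a≢b sa≡sb)

      advance : ∀ {L : List (Fin (2 * m))} p {x y Y} →
                L ≡ p ++ x ∷ y ∷ Y → L ≡ (p ∷ʳ x) ++ y ∷ Y
      advance p L≡ = trans L≡ (sym (∷ʳ-++ p _ _))

      walks-agree : ∀ p x A B → L₁ ≡ p ++ x ∷ A → L₂ ≡ p ++ x ∷ B →
                    Walk G (x ∷ A) → Walk G (x ∷ B) → length A ≡ length B → A ≡ B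
      walks-agree p x [] [] _ _ _ _ _ = refl
      walks-agree p x (a ∷ A) (b ∷ B) L₁≡ L₂≡ (x→a , wA) (x→b , wB) len
        with refl ← next-edge-agrees (advance p L₁≡) (advance p L₂≡) (trans (sym x→a) x→b) =
        cong (a ∷_) (walks-agree (p ∷ʳ x) a A B (advance p L₁≡) (advance p L₂≡) wA wB
                                 (suc-injective len))

    walk-determined-by-signature :
      ∀ {x A B} → Unique (x ∷ A) → Unique (x ∷ B) → Walk G (x ∷ A) → Walk G (x ∷ B) →
      length A ≡ length B → (∀ v → exitSignature (x ∷ A) v ≡ exitSignature (x ∷ B) v) → A ≡ B
    walk-determined-by-signature {x} {A} {B} uA uB wA wB len same =
      walks-agree uA uB same [] x A B refl refl wA wB len

module _ {n} (N : Digraph (suc n)) (outdeg≤2 : ∀ v → outdeg N v ≤ 2) where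

  root : Fin (2 * suc n)
  root = Fin.zero

  rootedTail : Eulerian N → List (Fin (2 * suc n))
  rootedTail c = proj₁ (rootAt N root c)

  rooted-rotation : ∀ c → Rotated (edges c) (root ∷ rootedTail c)
  rooted-rotation c = proj₁ (proj₂ (rootAt N root c))

  rooted-walk : ∀ c → Walk N (root ∷ rootedTail c)
  rooted-walk c = proj₂ (proj₂ (rootAt N root c))

  rooted↭allFin : ∀ c → root ∷ rootedTail c ↭ allFin (2 * suc n)
  rooted↭allFin c = ↭-trans (↭-sym (Rotated⇒↭ (rooted-rotation c))) (perm c)

  rooted-unique : ∀ c → Unique (root ∷ rootedTail c)
  rooted-unique c = Unique-resp-↭ (setoid _) (↭⇒↭ₛ (↭-sym (rooted↭allFin c))) (allFin⁺ _)

  rootedSignature : Eulerian N → Fin (suc n) → Bool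
  rootedSignature c = exitSignature N (root ∷ rootedTail c)

  -- src N root is omitted: its signature is forced by the root edge.
  cycleCode : Eulerian N → Fin (2 ^ n)
  cycleCode c = encode (rootedSignature c ∘ punchIn (src N root))

  cycleCode-injective : ∀ {c d} → cycleCode c ≡ cycleCode d → Rotation c d
  cycleCode-injective {c} {d} codes≡ =
    Rotated⇒drop-take (Rotated-trans (rooted-rotation c)
      (subst (λ T → Rotated (root ∷ T) (edges d)) (sym tails≡) (Rotated-sym (rooted-rotation d))))
    where
    sameSignature : ∀ v → rootedSignature c v ≡ rootedSignature d v
    sameSignature v = by-cases (src N root ≟ v)
      where
      by-cases : Dec (src N root ≡ v) → rootedSignature c v ≡ rootedSignature d v
      by-cases (yes refl) =
        trans (exitSignature-head N root (rootedTail c)) (sym (exitSignature-head N root (rootedTail d)))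
      by-cases (no r≢v) = subst (λ w → rootedSignature c w ≡ rootedSignature d w)
                            (punchIn-punchOut r≢v) (encode-injective _ _ codes≡ (punchOut r≢v))
    tails≡ : rootedTail c ≡ rootedTail d
    tails≡ = walk-determined-by-signature N outdeg≤2 (rooted-unique c) (rooted-unique d)
               (rooted-walk c) (rooted-walk d)
               (suc-injective (trans (↭-length (rooted↭allFin c)) (sym (↭-length (rooted↭allFin d)))))
               sameSignature

corollary2 : (m : ℕ) → 1 ≤ m → (N : Digraph m) → IsTNet N →
    NumEulerianCycles≤ N (2 ^ (m ∸ 1))
corollary2 (suc n) _ N isTNet =
  length≤-by-code (cycleCode N outdeg≤2) (λ {c d} → cycleCode-injective N outdeg≤2 {c} {d})
  where
  outdeg≤2 : ∀ v → outdeg N v ≤ 2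
  outdeg≤2 v = ≤-reflexive (proj₂ (isTNet v))
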